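{- Let $G$ be a connected unicyclic graph that is not König–Egerváry, whose unique cycle has length $2m+1$. Consider any sequence of steps of the procedure below that produces $G$, and let $R$ be the set of red vertices of the resulting coloring. Then $\mu(G)=|R|+m$. Procedure: (1) Construct an odd cycle and color its vertices blue. (2) Either perform step (3), or perform step (4), or stop. (3) Choose any existing vertex $u$, add two new vertices $u_1,u_2$ and edges $uu_1, u_1u_2$; color $u_1$ red and $u_2$ black; go to (2). (4) If there is a red vertex, choose a red vertex $u$, add a new vertex $u_1$ and the edge $uu_1$, color $u_1$ black; go to (2).
   Context: All graphs are finite and simple. $\alpha(G)$ is the maximum size of an independent set, $\mu(G)$ the maximum size of a matching; $G$ is König–Egerváry if $\alpha(G)+\mu(G)=|V(G)|$; unicyclic means having exactly one cycle. Every connected unicyclic non-König–Egerváry graph is (isomorphic to a graph) produced by the procedure. -}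

module Defs where

open import Data.Nat using (ℕ; zero; suc; _+_; _*_; _≤_; _%_; _≡ᵇ_)
open import Data.Bool using (Bool; true; false; _∨_)
open import Data.Fin using (Fin; zero; suc; toℕ; _≟_)
open import Data.Fin.Subset using (Subset; _∈_; ∣_∣)
open import Data.Vec using (tabulate)
open import Data.List using (List; length; concatMap; _∷_; [])
open import Data.List.Relation.Unary.All using (All)
open import Data.List.Relation.Unary.Unique.Propositional using (Unique)
open import Data.Product using (Σ; ∃; ∃-syntax; _×_; _,_; proj₁; proj₂)
open import Data.Sum using (_⊎_)
open import Relation.Nullary using (¬_)
open import Relation.Nullary.Decidable using (⌊_⌋)
open import Relation.Binary.PropositionalEquality using (_≡_)

record Graph (n : ℕ) : Set where
  field
    adj    : Fin n → Fin n → Bool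
    sym    : ∀ i j → adj i j ≡ adj j i
    irrefl : ∀ i → adj i i ≡ false
open Graph public

module _ {n : ℕ} (G : Graph n) where

  Independent : Subset n → Set
  Independent S = ∀ i j → i ∈ S → j ∈ S → adj G i j ≡ false

  IsAlpha : ℕ → Set
  IsAlpha a = (Σ (Subset n) λ S → Independent S × ∣ S ∣ ≡ a)
            × (∀ S → Independent S → ∣ S ∣ ≤ a)

  endpoints : List (Fin n × Fin n) → List (Fin n)
  endpoints = concatMap (λ e → proj₁ e ∷ proj₂ e ∷ [])

  IsMatching : List (Fin n × Fin n) → Set
  IsMatching M = All (λ e → adj G (proj₁ e) (proj₂ e) ≡ true) M
               × Unique (endpoints M)

  IsMu : ℕ → Set
  IsMu k = (Σ (List (Fin n × Fin n)) λ M → IsMatching M × length M ≡ k)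
         × (∀ M → IsMatching M → length M ≤ k)

  KönigEgerváry : Set
  KönigEgerváry = ∃[ a ] ∃[ b ] (IsAlpha a × IsMu b × a + b ≡ n)

  data Reach : Fin n → Fin n → Set where
    here  : ∀ {i} → Reach i i
    there : ∀ {i j k} → adj G i j ≡ true → Reach j k → Reach i k

  Connected : Set
  Connected = ∀ i j → Reach i j

  record Cycle : Set where
    field
      len′     : ℕ
      vtx      : Fin (3 + len′) → Fin n
      distinct : ∀ i j → vtx i ≡ vtx j → i ≡ j
      closed   : ∀ (i j : Fin (3 + len′)) →
                 toℕ j ≡ suc (toℕ i) % (3 + len′) → adj G (vtx i) (vtx j) ≡ true

  cycleLength : Cycle → ℕ
  cycleLength C = 3 + Cycle.len′ C

  -- edge set of a cycle (cycles are identified by their edge sets)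
  CycleEdge : Cycle → Fin n → Fin n → Set
  CycleEdge C x y = ∃[ i ] ∃[ j ]
    (toℕ j ≡ suc (toℕ i) % (3 + len′)
     × ((x ≡ vtx i × y ≡ vtx j) ⊎ (x ≡ vtx j × y ≡ vtx i)))
    where open Cycle C

  SameCycle : Cycle → Cycle → Set
  SameCycle C D = ∀ x y → (CycleEdge C x y → CycleEdge D x y)
                        × (CycleEdge D x y → CycleEdge C x y)

  Unicyclic : Set
  Unicyclic = Σ Cycle λ C → ∀ D → SameCycle C D

-- The procedure.  New vertices are added as index 0, shifting old ones.

data Color : Set where
  blue red black : Color

isRed : Color → Bool
isRed red = true
isRed _   = false

oddCycleAdj : (k : ℕ) → Fin (3 + 2 * k) → Fin (3 + 2 * k) → Bool
oddCycleAdj k i j = (toℕ j ≡ᵇ suc (toℕ i) % (3 + 2 * k))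
                  ∨ (toℕ i ≡ᵇ suc (toℕ j) % (3 + 2 * k))

addLeaf : ∀ {n} → (Fin n → Fin n → Bool) → Fin n → Fin (suc n) → Fin (suc n) → Bool
addLeaf A u zero    zero    = false
addLeaf A u zero    (suc j) = ⌊ j ≟ u ⌋
addLeaf A u (suc i) zero    = ⌊ i ≟ u ⌋
addLeaf A u (suc i) (suc j) = A i j

addColor : ∀ {n} → (Fin n → Color) → Color → Fin (suc n) → Color
addColor c col zero    = col
addColor c col (suc i) = c i

data Run : (n : ℕ) → (Fin n → Fin n → Bool) → (Fin n → Color) → Set where
  start : (k : ℕ) → Run (3 + 2 * k) (oddCycleAdj k) (λ _ → blue)
  -- (3) u – u₁ – u₂ with u₁ red, u₂ black
  step3 : ∀ {n A c} → Run n A c → (u : Fin n) →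
          Run (suc (suc n)) (addLeaf (addLeaf A u) zero) (addColor (addColor c red) black)
  step4 : ∀ {n A c} → Run n A c → (u : Fin n) → c u ≡ red →
          Run (suc n) (addLeaf A u) (addColor c black)

redCount : ∀ {n} → (Fin n → Color) → ℕ
redCount c = ∣ tabulate (λ i → isRed (c i)) ∣

module Submission where

-- Every edge of a graph produced by the procedure has a red endpoint or joins two vertices of
-- the initial odd cycle C: step (3) adds edges at the red u₁, step (4) at a red u.  In a matching
-- the red vertices are distinct endpoints, so charging each edge either to one red endpoint or
-- to its two cycle endpoints gives 2μ ≤ 2|R| + |C| = 2|R| + 2m + 1, i.e. μ ≤ |R| + m.
-- Conversely m alternate edges of C together with the edges u₁u₂ of step (3) form a matching of
-- size |R| + m.  The image of C is a cycle of G, hence its unique cycle, which identifies m.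

open import Defs hiding (sym)
open import Data.Bool using (Bool; true)
open import Data.Bool.Properties using (T-≡; T-∨)
open import Data.Fin using (Fin; zero; suc; toℕ; fromℕ<; _↑ʳ_; _≟_)
open import Data.Fin.Properties using (suc-injective; toℕ<n; toℕ-fromℕ<; injective⇒≤)
open import Data.Fin.Subset using (Subset; _∈_; ∣_∣; ⊤; inside; outside)
open import Data.Fin.Subset.Properties using (drop-there; ∈⊤; ∣⊤∣≡n)
open import Data.List using (List; []; _∷_; length; map; concatMap)
open import Data.List.Properties using (length-map)
open import Data.List.Relation.Binary.Sublist.Propositional using (_⊆_; []; _∷_; _∷ʳ_)
open import Data.List.Relation.Binary.Sublist.Propositional.Properties using (All-resp-⊆)
open import Data.List.Relation.Unary.All as All using (All; []; _∷_)
import Data.List.Relation.Unary.All.Properties as All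
open import Data.List.Relation.Unary.AllPairs using ([]; _∷_)
open import Data.List.Relation.Unary.Unique.Propositional using (Unique)
import Data.List.Relation.Unary.Unique.Propositional.Properties as Unique
open import Data.Nat using (ℕ; zero; suc; _+_; _*_; _%_; _≤_; _<_; z≤n; s≤s)
open import Data.Nat.DivMod using (m<n⇒m%n≡m; m%n<n)
open import Data.Nat.Properties
  using (≤-trans; ≤-reflexive; ≤-antisym; n≤1+n; +-suc; +-mono-≤; *-monoˡ-≤; *-comm;
         *-cancelˡ-≡; +-cancelʳ-≡; ≡⇒≡ᵇ; module ≤-Reasoning)
open import Data.Nat.Solver using (module +-*-Solver)
open import Data.Product using (Σ; _×_; _,_; proj₁; proj₂)
open import Data.Sum using (_⊎_; inj₁; inj₂)
open import Data.Vec using ([]; _∷_; tabulate; here; there)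
open import Data.Vec.Properties using (lookup∘tabulate; lookup⇒[]=)
open import Function using (_∘_)
open import Function.Bundles using (_↔_; Inverse; Injection; Equivalence)
open import Function.Definitions using (Injective)
open import Function.Properties.Inverse using (Inverse⇒Injection; ↔-sym)
open import Relation.Nullary using (¬_; yes)
open import Relation.Binary.PropositionalEquality

predecessors : ∀ {n} → List (Fin (suc n)) → List (Fin n)
predecessors []           = []
predecessors (zero  ∷ xs) = predecessors xs
predecessors (suc x ∷ xs) = x ∷ predecessors xs

predecessors-∈ : ∀ {n b} {p : Subset n} {xs} → All (_∈ b ∷ p) xs → All (_∈ p) (predecessors xs)
predecessors-∈ {xs = []}        []          = []
predecessors-∈ {xs = zero  ∷ _} (_  ∷ xs∈) = predecessors-∈ xs∈
predecessors-∈ {xs = suc _ ∷ _} (x∈ ∷ xs∈) = drop-there x∈ ∷ predecessors-∈ xs∈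

predecessors-≢ : ∀ {n} {x : Fin n} {xs} → All (λ y → ¬ suc x ≡ y) xs → All (λ y → ¬ x ≡ y) (predecessors xs)
predecessors-≢ {xs = []}        []         = []
predecessors-≢ {xs = zero  ∷ _} (_ ∷ ≢s)  = predecessors-≢ ≢s
predecessors-≢ {xs = suc _ ∷ _} (≢ ∷ ≢s)  = (≢ ∘ cong suc) ∷ predecessors-≢ ≢s

predecessors-unique : ∀ {n} {xs : List (Fin (suc n))} → Unique xs → Unique (predecessors xs)
predecessors-unique {xs = []}        []          = []
predecessors-unique {xs = zero  ∷ _} (_  ∷ uxs) = predecessors-unique uxs
predecessors-unique {xs = suc _ ∷ _} (≢s ∷ uxs) = predecessors-≢ ≢s ∷ predecessors-unique uxs

length-predecessors : ∀ {n} {xs : List (Fin (suc n))} → All (λ y → ¬ zero ≡ y) xs →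
                      length xs ≡ length (predecessors xs)
length-predecessors {xs = []}        []        = refl
length-predecessors {xs = zero  ∷ _} (≢ ∷ _)  with () ← ≢ refl
length-predecessors {xs = suc _ ∷ _} (_ ∷ ≢s) = cong suc (length-predecessors ≢s)

length-predecessors-unique : ∀ {n} {xs : List (Fin (suc n))} → Unique xs →
                             length xs ≤ suc (length (predecessors xs))
length-predecessors-unique {xs = []}        []         = z≤n
length-predecessors-unique {xs = zero  ∷ _} (≢s ∷ _)  = s≤s (≤-reflexive (length-predecessors ≢s))
length-predecessors-unique {xs = suc _ ∷ _} (_ ∷ uxs) = s≤s (length-predecessors-unique uxs)

zero∉outside : ∀ {n} {p : Subset n} {y} → y ∈ outside ∷ p → ¬ zero ≡ y
zero∉outside () refl

unique⇒length≤∣p∣ : ∀ {n} (p : Subset n) {xs} → Unique xs → All (_∈ p) xs → length xs ≤ ∣ p ∣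
unique⇒length≤∣p∣ []            {[]} _ _ = z≤n
unique⇒length≤∣p∣ (outside ∷ p) uxs xs∈ = ≤-trans
  (≤-reflexive (length-predecessors (All.map zero∉outside xs∈)))
  (unique⇒length≤∣p∣ p (predecessors-unique uxs) (predecessors-∈ xs∈))
unique⇒length≤∣p∣ (inside ∷ p)  uxs xs∈ = ≤-trans
  (length-predecessors-unique uxs)
  (s≤s (unique⇒length≤∣p∣ p (predecessors-unique uxs) (predecessors-∈ xs∈)))

unique-⊆ : ∀ {A : Set} {xs ys : List A} → xs ⊆ ys → Unique ys → Unique xs
unique-⊆ []            []          = []
unique-⊆ (_ ∷ʳ xs⊆)    (_ ∷ uys)   = unique-⊆ xs⊆ uys
unique-⊆ (refl ∷ xs⊆)  (≢s ∷ uys)  = All-resp-⊆ xs⊆ ≢s ∷ unique-⊆ xs⊆ uys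

Edges : ℕ → Set
Edges n = List (Fin n × Fin n)

ends : ∀ {n} → Edges n → List (Fin n)
ends = concatMap (λ e → proj₁ e ∷ proj₂ e ∷ [])

Matching : ∀ {n} → (Fin n → Fin n → Set) → Edges n → Set
Matching E M = All (λ e → E (proj₁ e) (proj₂ e)) M × Unique (ends M)

Edge : ∀ {n} → (Fin n → Fin n → Bool) → Fin n → Fin n → Set
Edge A i j = A i j ≡ true

mapEdges : ∀ {n m} → (Fin n → Fin m) → Edges n → Edges m
mapEdges g = map (λ e → g (proj₁ e) , g (proj₂ e))

ends-mapEdges : ∀ {n m} (g : Fin n → Fin m) M → ends (mapEdges g M) ≡ map g (ends M)
ends-mapEdges g []      = refl
ends-mapEdges g (e ∷ M) = cong (λ xs → g (proj₁ e) ∷ g (proj₂ e) ∷ xs) (ends-mapEdges g M)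

Matching-mono : ∀ {n} {E F : Fin n → Fin n → Set} → (∀ {a b} → E a b → F a b) →
                ∀ {M} → Matching E M → Matching F M
Matching-mono E⇒F (M⊆E , uM) = All.map E⇒F M⊆E , uM

Matching-map : ∀ {n m} {E : Fin n → Fin n → Set} {F : Fin m → Fin m → Set} {g : Fin n → Fin m} →
               Injective _≡_ _≡_ g → (∀ {a b} → E a b → F (g a) (g b)) →
               ∀ {M} → Matching E M → Matching F (mapEdges g M)
Matching-map {g = g} g-inj E⇒F {M} (M⊆E , uM) =
  All.map⁺ (All.map E⇒F M⊆E) ,
  subst Unique (sym (ends-mapEdges g M)) (Unique.map⁺ g-inj uM)

Matching-extend₂ : ∀ {n} {E : Fin (2 + n) → Fin (2 + n) → Set} {F : Fin n → Fin n → Set} →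
                   E zero (suc zero) → (∀ {a b} → F a b → E (2 ↑ʳ a) (2 ↑ʳ b)) →
                   ∀ {M} → Matching F M → Matching E ((zero , suc zero) ∷ mapEdges (2 ↑ʳ_) M)
Matching-extend₂ {E = E} E01 F⇒E {M} m =
  E01 ∷ proj₁ shifted , ((λ ()) ∷ fresh (λ ())) ∷ fresh (λ ()) ∷ proj₂ shifted
  where
  shifted : Matching E (mapEdges (2 ↑ʳ_) M)
  shifted = Matching-map (suc-injective ∘ suc-injective) F⇒E m
  fresh : ∀ {x} → (∀ {y} → ¬ x ≡ 2 ↑ʳ y) → All (λ y → ¬ x ≡ y) (ends (mapEdges (2 ↑ʳ_) M))
  fresh ≢ = subst (All _) (sym (ends-mapEdges (2 ↑ʳ_) M)) (All.map⁺ (All.universal (λ _ → ≢) (ends M)))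

+-suc² : ∀ m n → m + suc (suc n) ≡ suc (suc (m + n))
+-suc² m n = trans (+-suc m (suc n)) (cong suc (+-suc m n))

module _ {n} (P Q : Subset n) where

  Covered : Fin n × Fin n → Set
  Covered (a , b) = (a ∈ P ⊎ b ∈ P) ⊎ (a ∈ Q × b ∈ Q)

  record CoverSplit (M : Edges n) : Set where
    field
      endsP endsQ : List (Fin n)
      endsP⊆      : endsP ⊆ ends M
      endsQ⊆      : endsQ ⊆ ends M
      endsP∈      : All (_∈ P) endsP
      endsQ∈      : All (_∈ Q) endsQ
      weight      : length M * 2 ≡ length endsP * 2 + length endsQ

  coverSplit : ∀ M → All Covered M → CoverSplit M
  coverSplit []      [] = record
    { endsP = [] ; endsQ = [] ; endsP⊆ = [] ; endsQ⊆ = [] ; endsP∈ = [] ; endsQ∈ = [] ; weight = refl }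
  coverSplit ((a , b) ∷ M) (cov ∷ covs) with coverSplit M covs | cov
  ... | s | inj₁ (inj₁ a∈P) = record
    { endsP = a ∷ endsP ; endsQ = endsQ ; endsP⊆ = refl ∷ b ∷ʳ endsP⊆ ; endsQ⊆ = a ∷ʳ b ∷ʳ endsQ⊆
    ; endsP∈ = a∈P ∷ endsP∈ ; endsQ∈ = endsQ∈ ; weight = cong (2 +_) weight }
    where open CoverSplit s
  ... | s | inj₁ (inj₂ b∈P) = record
    { endsP = b ∷ endsP ; endsQ = endsQ ; endsP⊆ = a ∷ʳ refl ∷ endsP⊆ ; endsQ⊆ = a ∷ʳ b ∷ʳ endsQ⊆
    ; endsP∈ = b∈P ∷ endsP∈ ; endsQ∈ = endsQ∈ ; weight = cong (2 +_) weight }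
    where open CoverSplit s
  ... | s | inj₂ (a∈Q , b∈Q) = record
    { endsP = endsP ; endsQ = a ∷ b ∷ endsQ ; endsP⊆ = a ∷ʳ b ∷ʳ endsP⊆ ; endsQ⊆ = refl ∷ refl ∷ endsQ⊆
    ; endsP∈ = endsP∈ ; endsQ∈ = a∈Q ∷ b∈Q ∷ endsQ∈
    ; weight = trans (cong (2 +_) weight) (sym (+-suc² (length endsP * 2) (length endsQ))) }
    where open CoverSplit s

  covered-matching-bound : ∀ {M} → All Covered M → Unique (ends M) → length M * 2 ≤ ∣ P ∣ * 2 + ∣ Q ∣
  covered-matching-bound {M} covs uM = ≤-trans (≤-reflexive weight)
    (+-mono-≤ (*-monoˡ-≤ 2 (unique⇒length≤∣p∣ P (unique-⊆ endsP⊆ uM) endsP∈))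
              (unique⇒length≤∣p∣ Q (unique-⊆ endsQ⊆ uM) endsQ∈))
    where open CoverSplit (coverSplit M covs)

Consecutive : ∀ {N} → Fin N → Fin N → Set
Consecutive i j = toℕ j ≡ suc (toℕ i)

pathMatching : ∀ h {N} → h * 2 ≤ N → Edges N
pathMatching zero    _                = []
pathMatching (suc h) (s≤s (s≤s h≤N)) = (zero , suc zero) ∷ mapEdges (2 ↑ʳ_) (pathMatching h h≤N)

length-pathMatching : ∀ h {N} (h≤N : h * 2 ≤ N) → length (pathMatching h h≤N) ≡ h
length-pathMatching zero    _                = refl
length-pathMatching (suc h) (s≤s (s≤s h≤N)) =
  cong suc (trans (length-map _ (pathMatching h h≤N)) (length-pathMatching h h≤N))

pathMatching-matching : ∀ h {N} (h≤N : h * 2 ≤ N) → Matching Consecutive (pathMatching h h≤N)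
pathMatching-matching zero    _                = [] , []
pathMatching-matching (suc h) (s≤s (s≤s h≤N)) =
  Matching-extend₂ refl (cong (2 +_)) (pathMatching-matching h h≤N)

oddCycle-successor : ∀ k (i j : Fin (3 + 2 * k)) → toℕ j ≡ suc (toℕ i) % (3 + 2 * k) → Edge (oddCycleAdj k) i j
oddCycle-successor k i j j≡ = Equivalence.to T-≡ (Equivalence.from T-∨ (inj₁ (≡⇒≡ᵇ _ _ j≡)))

consecutive⇒oddCycleEdge : ∀ k {i j : Fin (3 + 2 * k)} → Consecutive i j → Edge (oddCycleAdj k) i j
consecutive⇒oddCycleEdge k {i} {j} j≡ =
  oddCycle-successor k i j (trans j≡ (sym (m<n⇒m%n≡m (subst (_< 3 + 2 * k) j≡ (toℕ<n j)))))

cycleK : ∀ {n A c} → Run n A c → ℕ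
cycleK (start k)     = k
cycleK (step3 r _)   = cycleK r
cycleK (step4 r _ _) = cycleK r

redSet : ∀ {n} → (Fin n → Color) → Subset n
redSet c = tabulate (isRed ∘ c)

red∈redSet : ∀ {n} {c : Fin n → Color} {x} → c x ≡ red → x ∈ redSet c
red∈redSet {c = c} {x} cx≡red = lookup⇒[]= x _ (trans (lookup∘tabulate (isRed ∘ c) x) (cong isRed cx≡red))

redCount-blue : ∀ n → redCount {n} (λ _ → blue) ≡ 0
redCount-blue zero    = refl
redCount-blue (suc n) = redCount-blue n

onCycle : ∀ {n A c} → Run n A c → Subset n
onCycle (start k)     = ⊤
onCycle (step3 r _)   = outside ∷ outside ∷ onCycle r
onCycle (step4 r _ _) = outside ∷ onCycle r

∣onCycle∣ : ∀ {n A c} (r : Run n A c) → ∣ onCycle r ∣ ≡ 3 + 2 * cycleK r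
∣onCycle∣ (start k)     = ∣⊤∣≡n (3 + 2 * k)
∣onCycle∣ (step3 r _)   = ∣onCycle∣ r
∣onCycle∣ (step4 r _ _) = ∣onCycle∣ r

Covered-suc : ∀ {n} {P Q : Subset n} {b b′ i j} → Covered P Q (i , j) → Covered (b ∷ P) (b′ ∷ Q) (suc i , suc j)
Covered-suc (inj₁ (inj₁ i∈P))  = inj₁ (inj₁ (there i∈P))
Covered-suc (inj₁ (inj₂ j∈P))  = inj₁ (inj₂ (there j∈P))
Covered-suc (inj₂ (i∈Q , j∈Q)) = inj₂ (there i∈Q , there j∈Q)

run-edge-covered : ∀ {n A c} (r : Run n A c) {i j} → Edge A i j → Covered (redSet c) (onCycle r) (i , j)
run-edge-covered (start k) _ = inj₂ (∈⊤ , ∈⊤)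
run-edge-covered (step3 r u) {zero}        {suc zero}    _ = inj₁ (inj₂ (there here))
run-edge-covered (step3 r u) {suc zero}    {_}           _ = inj₁ (inj₁ (there here))
run-edge-covered (step3 r u) {suc (suc i)} {suc zero}    _ = inj₁ (inj₂ (there here))
run-edge-covered (step3 r u) {suc (suc i)} {suc (suc j)} e = Covered-suc (Covered-suc (run-edge-covered r e))
run-edge-covered (step4 r u u-red) {zero}  {suc j} e with j ≟ u
... | yes refl = inj₁ (inj₂ (there (red∈redSet u-red)))
run-edge-covered (step4 r u u-red) {suc i} {zero}  e with i ≟ u
... | yes refl = inj₁ (inj₁ (there (red∈redSet u-red)))
run-edge-covered (step4 r u u-red) {suc i} {suc j} e = Covered-suc (run-edge-covered r e)

run-matching : ∀ {n A c} (r : Run n A c) →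
               Σ (Edges n) λ M → Matching (Edge A) M × length M ≡ redCount c + suc (cycleK r)
run-matching (start k) =
  pathMatching (suc k) k+1≤ ,
  Matching-mono (consecutive⇒oddCycleEdge k) (pathMatching-matching (suc k) k+1≤) ,
  trans (length-pathMatching (suc k) k+1≤) (cong (_+ suc k) (sym (redCount-blue (3 + 2 * k))))
  where
  k+1≤ : suc k * 2 ≤ 3 + 2 * k
  k+1≤ = s≤s (s≤s (≤-trans (≤-reflexive (*-comm k 2)) (n≤1+n (2 * k))))
run-matching (step3 r u) with run-matching r
... | M , m , |M| = (zero , suc zero) ∷ mapEdges (2 ↑ʳ_) M ,
                    Matching-extend₂ refl (λ e → e) m ,
                    cong suc (trans (length-map _ M) |M|)
run-matching (step4 r u _) with run-matching r
... | M , m , |M| = mapEdges suc M , Matching-map suc-injective (λ e → e) m , trans (length-map _ M) |M|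

halve : ∀ x y → x * 2 ≤ y * 2 + 1 → x ≤ y
halve zero    y       _                = z≤n
halve (suc x) zero    (s≤s ())
halve (suc x) (suc y) (s≤s (s≤s x≤y)) = s≤s (halve x y x≤y)

run-matching-bound : ∀ {n A c} (r : Run n A c) {M} → Matching (Edge A) M → length M ≤ redCount c + suc (cycleK r)
run-matching-bound {c = c} r {M} (M⊆A , uM) = halve (length M) (redCount c + suc k) (begin
  length M * 2                    ≤⟨ covered-matching-bound (redSet c) (onCycle r) (All.map (run-edge-covered r) M⊆A) uM ⟩
  redCount c * 2 + ∣ onCycle r ∣  ≡⟨ cong (redCount c * 2 +_) (∣onCycle∣ r) ⟩
  redCount c * 2 + (3 + 2 * k)    ≡⟨ solve 2 (λ R k → R :* con 2 :+ (con 3 :+ con 2 :* k) := (R :+ (con 1 :+ k)) :* con 2 :+ con 1) refl (redCount c) k ⟩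
  (redCount c + suc k) * 2 + 1    ∎)
  where
  k = cycleK r
  open ≤-Reasoning
  open +-*-Solver

cycleEmbedding : ∀ {n A c} (r : Run n A c) → Fin (3 + 2 * cycleK r) → Fin n
cycleEmbedding (start k)     i = i
cycleEmbedding (step3 r _)   i = 2 ↑ʳ cycleEmbedding r i
cycleEmbedding (step4 r _ _) i = suc (cycleEmbedding r i)

cycleEmbedding-injective : ∀ {n A c} (r : Run n A c) → Injective _≡_ _≡_ (cycleEmbedding r)
cycleEmbedding-injective (start k)     eq = eq
cycleEmbedding-injective (step3 r _)   eq = cycleEmbedding-injective r (suc-injective (suc-injective eq))
cycleEmbedding-injective (step4 r _ _) eq = cycleEmbedding-injective r (suc-injective eq)

cycleEmbedding-adj : ∀ {n A c} (r : Run n A c) i j →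
                     A (cycleEmbedding r i) (cycleEmbedding r j) ≡ oddCycleAdj (cycleK r) i j
cycleEmbedding-adj (start k)     i j = refl
cycleEmbedding-adj (step3 r _)   i j = cycleEmbedding-adj r i j
cycleEmbedding-adj (step4 r _ _) i j = cycleEmbedding-adj r i j

runCycle : ∀ {n n′ A c} (G : Graph n) (r : Run n′ A c) (g : Fin n′ → Fin n) → Injective _≡_ _≡_ g →
           (∀ {a b} → Edge A a b → Edge (adj G) (g a) (g b)) → Cycle G
runCycle G r g g-inj A⇒G = record
  { len′     = 2 * cycleK r
  ; vtx      = g ∘ cycleEmbedding r
  ; distinct = λ i j eq → cycleEmbedding-injective r (g-inj eq)
  ; closed   = λ i j j≡ → A⇒G (trans (cycleEmbedding-adj r i j) (oddCycle-successor (cycleK r) i j j≡))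
  }

cycleLength-mono : ∀ {n} (G : Graph n) (C D : Cycle G) → (∀ x y → CycleEdge G C x y → CycleEdge G D x y) →
                   cycleLength G C ≤ cycleLength G D
cycleLength-mono G C D C⊆D = injective⇒≤ {f = proj₁ ∘ preimage} preimage-injective
  where
  module C = Cycle C
  module D = Cycle D
  preimage : ∀ i → Σ (Fin (3 + D.len′)) λ j → D.vtx j ≡ C.vtx i
  preimage i with C⊆D (C.vtx i) (C.vtx i⁺) (i , i⁺ , toℕ-fromℕ< (m%n<n (suc (toℕ i)) (3 + C.len′)) , inj₁ (refl , refl))
    where i⁺ = fromℕ< (m%n<n (suc (toℕ i)) (3 + C.len′))
  ... | j , _ , _ , inj₁ (eq , _) = j , sym eq
  ... | _ , j , _ , inj₂ (eq , _) = j , sym eq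
  preimage-injective : Injective _≡_ _≡_ (proj₁ ∘ preimage)
  preimage-injective {i} {i′} eq =
    C.distinct i i′ (trans (sym (proj₂ (preimage i))) (trans (cong D.vtx eq) (proj₂ (preimage i′))))

unicyclic-cycleLength : ∀ {n} (G : Graph n) (U : Unicyclic G) (D : Cycle G) →
                        cycleLength G (proj₁ U) ≡ cycleLength G D
unicyclic-cycleLength G (C , unique) D = ≤-antisym
  (cycleLength-mono G C D (λ x y → proj₁ (unique D x y)))
  (cycleLength-mono G D C (λ x y → proj₂ (unique D x y)))

module _ {n n′} (G : Graph n) {A : Fin n′ → Fin n′ → Bool} (f : Fin n′ ↔ Fin n)
         (A≡G : ∀ i j → A i j ≡ adj G (Inverse.to f i) (Inverse.to f j)) where
  open Inverse f

  to-injective : Injective _≡_ _≡_ to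
  to-injective = Injection.injective (Inverse⇒Injection f)

  from-injective : Injective _≡_ _≡_ from
  from-injective = Injection.injective (Inverse⇒Injection (↔-sym f))

  to-edge : ∀ {a b} → Edge A a b → Edge (adj G) (to a) (to b)
  to-edge {a} {b} = trans (sym (A≡G a b))

  from-edge : ∀ {x y} → Edge (adj G) x y → Edge A (from x) (from y)
  from-edge {x} {y} xy = trans (A≡G (from x) (from y))
    (subst₂ (Edge (adj G)) (sym (strictlyInverseˡ x)) (sym (strictlyInverseˡ y)) xy)

  IsMu-transfer : ∀ {s} → (Σ (Edges n′) λ M → Matching (Edge A) M × length M ≡ s) →
                  (∀ {M} → Matching (Edge A) M → length M ≤ s) → IsMu G s
  IsMu-transfer (M , m , |M|≡s) bound =
    (mapEdges to M , Matching-map to-injective to-edge m , trans (length-map _ M) |M|≡s) ,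
    λ M m → subst (_≤ _) (length-map _ M) (bound (Matching-map from-injective from-edge m))

2*m+1≡3+2*k⇒m≡1+k : ∀ m k → 2 * m + 1 ≡ 3 + 2 * k → m ≡ suc k
2*m+1≡3+2*k⇒m≡1+k m k eq = *-cancelˡ-≡ m (suc k) 2 (+-cancelʳ-≡ 1 (2 * m) (2 * suc k)
  (trans eq (solve 1 (λ k → con 3 :+ con 2 :* k := con 2 :* (con 1 :+ k) :+ con 1) refl k)))
  where open +-*-Solver

-- Connectivity and the non-König–Egerváry property are what make G arise from the procedure.
corollary4p13 : ∀ {n} (G : Graph n) → Connected G → (U : Unicyclic G) → ¬ KönigEgerváry G →
    (m : ℕ) → cycleLength G (proj₁ U) ≡ 2 * m + 1 →
    ∀ {n′} {A : Fin n′ → Fin n′ → Bool} {c : Fin n′ → Color} → Run n′ A c →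
    (f : Fin n′ ↔ Fin n) → (∀ i j → A i j ≡ adj G (Inverse.to f i) (Inverse.to f j)) →
    IsMu G (redCount c + m)
corollary4p13 G _ U _ m |C|≡2m+1 {c = c} r f A≡G =
  subst (λ m → IsMu G (redCount c + m)) (sym m≡1+k)
        (IsMu-transfer G f A≡G (run-matching r) (run-matching-bound r))
  where
  m≡1+k : m ≡ suc (cycleK r)
  m≡1+k = 2*m+1≡3+2*k⇒m≡1+k m (cycleK r) (trans (sym |C|≡2m+1)
    (unicyclic-cycleLength G U (runCycle G r _ (to-injective G f A≡G) (to-edge G f A≡G))))
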